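{- For all integers $n\ge 0$, \[ a_{3,1}(n)\ge a_{3,2}(n)\ge a_{3,4}(n). \]
   Context: A partition of $n$ is a non-increasing sequence of positive integers summing to $n$; its Young diagram is the left-justified array of boxes whose $i$-th row has $\lambda_i$ boxes. The hook length of a box is the number of boxes directly to its right, plus the number directly below it, plus $1$; a box of hook length $k$ is a $k$-hook. For $t\ge 2$, a $t$-core partition is a partition none of whose hook lengths is divisible by $t$. $a_{t,k}(n)$ denotes the total number of hooks of length $k$ summed over all $t$-core partitions of $n$. -}

module Defs where

open import Data.Nat using (ℕ; zero; suc; _+_; _∸_; _≤_; _<ᵇ_; _≤ᵇ_; _%_; _≡ᵇ_)
open import Data.Bool using (Bool; true; false; if_then_else_; _∧_)
open import Data.List using (List; []; _∷_; map; length; concatMap; upTo; drop; _++_)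
open import Data.Nat.ListAction using (sum)

filterᵇ : {A : Set} → (A → Bool) → List A → List A
filterᵇ p []       = []
filterᵇ p (x ∷ xs) = if p x then x ∷ filterᵇ p xs else filterᵇ p xs

allᵇ : {A : Set} → (A → Bool) → List A → Bool
allᵇ p []       = true
allᵇ p (x ∷ xs) = p x ∧ allᵇ p xs



-- A partition is represented as the list of its parts (λ₁, λ₂, …),
-- required to be non-increasing with positive parts.
Partition : Set
Partition = List ℕ

-- partsLE m n : all partitions of n (non-increasing lists of positive
-- integers summing to n) whose largest part is ≤ m.
-- Structural recursion on a fuel argument f ≥ n.
partsLE' : ℕ → ℕ → ℕ → List Partition
partsLE' zero    m zero    = [] ∷ []
partsLE' zero    m (suc n) = []
partsLE' (suc f) m zero    = [] ∷ []
partsLE' (suc f) m (suc n) =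
  concatMap (λ k → map (λ p → suc k ∷ p) (partsLE' f (suc k) (suc n ∸ suc k)))
            (filterᵇ (λ k → suc k ≤ᵇ m) (upTo (suc n)))

partitions : ℕ → List Partition
partitions n = partsLE' n n n

part : Partition → ℕ → ℕ
part []       _       = 0
part (x ∷ _)  zero    = x
part (_ ∷ xs) (suc i) = part xs i

countGreater : List ℕ → ℕ → ℕ
countGreater []       j = 0
countGreater (x ∷ xs) j = (if j <ᵇ x then 1 else 0) + countGreater xs j

-- Hook length of the box in row i, column j (0-indexed, j < λ_i):
-- arm (boxes to the right) + leg (boxes below) + 1.
hook : Partition → ℕ → ℕ → ℕ
hook λ' i j = (part λ' i ∸ suc j) + countGreater (drop (suc i) λ') j + 1

hooks : Partition → List ℕ
hooks λ' = go 0 λ'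
  where
  go : ℕ → List ℕ → List ℕ
  go i []       = []
  go i (x ∷ xs) = map (hook λ' i) (upTo x) ++ go (suc i) xs

numHooks : ℕ → Partition → ℕ
numHooks k λ' = length (filterᵇ (λ h → h ≡ᵇ k) (hooks λ'))

divides? : ℕ → ℕ → Bool
divides? zero    h = h ≡ᵇ 0
divides? (suc t) h = (h % suc t) ≡ᵇ 0

isCore : ℕ → Partition → Bool
isCore t λ' = allᵇ (λ h → Data.Bool.not (divides? t h)) (hooks λ')

a : ℕ → ℕ → ℕ → ℕ
a t k n = sum (map (numHooks k) (filterᵇ (isCore t) (partitions n)))

{-# OPTIONS --safe #-}
module Submission where

-- The hook lengths in a row of a Young diagram are distinct, and if the row
-- overhangs the next one by d boxes they are 1, …, d together with d + 1 + h
-- for the hook lengths h of the next row.  So a_{t,k}(n) counts the rows with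
-- a k-hook in all t-cores of n, and in a 3-core no row has a 3-hook.  A row
-- with a 2-hook but no 1-hook then has overhang 0, and the row below it has a
-- 1-hook but no 2-hook (that would give a 3-hook above); a row with a 4-hook
-- but no 2-hook has overhang 1, and the row below it has a 2-hook but, lacking
-- a 1-hook, no 4-hook.  Charging such rows to the row below proves both
-- inequalities for each 3-core separately; the charging is a telescoping
-- induction on the rows.

open import Defs
open import Data.Nat
  using (ℕ; _≤_; zero; suc; _+_; _∸_; _<_; _≥_; _≡ᵇ_; _<ᵇ_; _≤ᵇ_; z≤n; s≤s; z<s; s<s)
open import Data.Product using (_×_; _,_; proj₁)

open import Data.Bool using (Bool; true; false; not; _∧_; T)
open import Data.Bool.Properties using (T-≡; T-∧)
open import Data.Empty using (⊥)
open import Data.List using (List; []; _∷_; _++_; map; length; upTo; applyUpTo)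
open import Data.List.Properties using (map-upTo)
open import Data.List.Relation.Unary.All as All using (All; []; _∷_)
open import Data.List.Relation.Unary.All.Properties using (concat⁺; map⁺)
open import Data.List.Relation.Unary.AllPairs using (AllPairs; []; _∷_)
open import Data.Nat.DivMod using (n%n≡0)
open import Data.Nat.ListAction using (sum)
open import Data.Nat.Properties
open import Algebra.Properties.CommutativeSemigroup +-commutativeSemigroup
  using (xy∙z≈xz∙y; xy∙z≈x∙zy)
open import Data.Nat.Solver using (module +-*-Solver)
open import Data.Sum using (_⊎_; inj₁; inj₂)
open import Data.Unit using (⊤; tt)
open import Function using (_∘_; Equivalence)
open import Relation.Binary.PropositionalEquality
open import Relation.Nullary using (contradiction)

mutual
  -- The local function `go` of `hooks` cannot be named outside its module; this
  -- meta is solved to it by unification in `hooksFrom-solution`, where `with`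
  -- turns its arguments into variables.
  hooksFrom : Partition → ℕ → List ℕ → List ℕ
  hooksFrom = _

  hooksFrom-solution : (ν : List ℕ) → hooks (0 ∷ ν) ≡ hooks (0 ∷ ν) → ⊤
  hooksFrom-solution ν eq with 0 ∷ ν | 1
  ... | μ | i = unify μ i ν eq
    where
    unify : ∀ μ i ν → hooksFrom μ i ν ≡ hooksFrom μ i ν → ⊤
    unify _ _ _ _ = tt

topRowHooks : Partition → List ℕ
topRowHooks μ = map (hook μ 0) (upTo (part μ 0))

hooks-∷ : ∀ x ν → hooks (x ∷ ν) ≡ topRowHooks (x ∷ ν) ++ hooks ν
hooks-∷ x ν = cong (topRowHooks (x ∷ ν) ++_) (hooksFrom-∷ 0 ν)
  where
  hooksFrom-∷ : ∀ i ys → hooksFrom (x ∷ ν) (suc i) ys ≡ hooksFrom ν i ys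
  hooksFrom-∷ i []       = refl
  hooksFrom-∷ i (y ∷ ys) = cong (map (hook ν i) (upTo y) ++_) (hooksFrom-∷ (suc i) ys)

indicator : Bool → ℕ
indicator true  = 1
indicator false = 0

indicator≡0⇒false : ∀ {b} → indicator b ≡ 0 → b ≡ false
indicator≡0⇒false {false} _ = refl

countBelow : (ℕ → Bool) → ℕ → ℕ
countBelow p zero    = 0
countBelow p (suc n) = indicator (p 0) + countBelow (p ∘ suc) n

countBelow-+ : ∀ p m n → countBelow p (m + n) ≡ countBelow p m + countBelow (p ∘ (m +_)) n
countBelow-+ p zero    n = refl
countBelow-+ p (suc m) n = trans (cong (indicator (p 0) +_) (countBelow-+ (p ∘ suc) m n))
                                 (sym (+-assoc (indicator (p 0)) _ _))

countBelow-cong : ∀ {p q} n → (∀ {j} → j < n → p j ≡ q j) → countBelow p n ≡ countBelow q n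
countBelow-cong zero    _   = refl
countBelow-cong (suc n) p≗q = cong₂ _+_ (cong indicator (p≗q z<s)) (countBelow-cong n (p≗q ∘ s<s))

countBelow-none : ∀ {p} n → (∀ {j} → j < n → p j ≡ false) → countBelow p n ≡ 0
countBelow-none     zero    _    = refl
countBelow-none {p} (suc n) none rewrite none z<s = countBelow-none n (none ∘ s<s)

module _ {A : Set} where

  length-filterᵇ-++ : ∀ (p : A → Bool) xs ys →
                      length (filterᵇ p (xs ++ ys)) ≡ length (filterᵇ p xs) + length (filterᵇ p ys)
  length-filterᵇ-++ p []       ys = refl
  length-filterᵇ-++ p (x ∷ xs) ys with p x
  ... | true  = cong suc (length-filterᵇ-++ p xs ys)
  ... | false = length-filterᵇ-++ p xs ys

  length-filterᵇ-applyUpTo : ∀ (p : A → Bool) f n →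
                             length (filterᵇ p (applyUpTo f n)) ≡ countBelow (p ∘ f) n
  length-filterᵇ-applyUpTo p f zero    = refl
  length-filterᵇ-applyUpTo p f (suc n) with p (f 0)
  ... | true  = cong suc (length-filterᵇ-applyUpTo p (f ∘ suc) n)
  ... | false = length-filterᵇ-applyUpTo p (f ∘ suc) n

  length-filterᵇ-none : ∀ (p q : A → Bool) → (∀ x → T (q x) → T (p x) → ⊥) →
                        ∀ xs → T (allᵇ p xs) → length (filterᵇ q xs) ≡ 0
  length-filterᵇ-none p q disjoint []       _   = refl
  length-filterᵇ-none p q disjoint (x ∷ xs) all with Equivalence.to T-∧ all | q x in qx
  ... | px , _   | true  = contradiction px (disjoint x (Equivalence.from T-≡ qx))
  ... | _  , pxs | false = length-filterᵇ-none p q disjoint xs pxs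

  filterᵇ-All : ∀ (p : A → Bool) {P : A → Set} → (∀ x → T (p x) → P x) →
                ∀ xs → All P (filterᵇ p xs)
  filterᵇ-All p P-if-p []       = []
  filterᵇ-All p P-if-p (x ∷ xs) with p x in px
  ... | true  = P-if-p x (Equivalence.from T-≡ px) ∷ filterᵇ-All p P-if-p xs
  ... | false = filterᵇ-All p P-if-p xs

  sum-map-filterᵇ-mono : ∀ (p : A → Bool) {f g : A → ℕ} {xs} →
                         All (λ x → T (p x) → f x ≤ g x) xs →
                         sum (map f (filterᵇ p xs)) ≤ sum (map g (filterᵇ p xs))
  sum-map-filterᵇ-mono p []                 = z≤n
  sum-map-filterᵇ-mono p {xs = x ∷ _} (f≤g ∷ fs≤gs) with p x
  ... | true  = +-mono-≤ (f≤g tt) (sum-map-filterᵇ-mono p fs≤gs)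
  ... | false = sum-map-filterᵇ-mono p fs≤gs

mutual
  -- Whether a row overhanging ν by d boxes has a k-hook.
  overhangHookᵇ : ℕ → Partition → ℕ → Bool
  overhangHookᵇ d       ν zero          = false
  overhangHookᵇ zero    ν (suc k)       = topHookᵇ ν k
  overhangHookᵇ (suc d) ν (suc zero)    = true
  overhangHookᵇ (suc d) ν (suc (suc k)) = overhangHookᵇ d ν (suc k)

  topHookᵇ : Partition → ℕ → Bool
  topHookᵇ []      k = false
  topHookᵇ (x ∷ ν) k = overhangHookᵇ (x ∸ part ν 0) ν k

topHookᵇ-0 : ∀ μ → topHookᵇ μ 0 ≡ false
topHookᵇ-0 []      = refl
topHookᵇ-0 (x ∷ ν) = refl

overhangHookᵇ-≤ : ∀ {d} ν ν′ {k} → k ≤ d → overhangHookᵇ d ν k ≡ overhangHookᵇ d ν′ k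
overhangHookᵇ-≤ ν ν′ {zero}        _               = refl
overhangHookᵇ-≤ ν ν′ {suc zero}    (s≤s _)         = refl
overhangHookᵇ-≤ ν ν′ {suc (suc k)} (s≤s (s≤s k≤d)) = overhangHookᵇ-≤ ν ν′ (s≤s k≤d)

overhangHookᵇ-+ : ∀ d ν k → overhangHookᵇ d ν (suc (d + k)) ≡ topHookᵇ ν k
overhangHookᵇ-+ zero    ν k = refl
overhangHookᵇ-+ (suc d) ν k = overhangHookᵇ-+ d ν k

overhangHookᵇ-[]-suc : ∀ d k → indicator (suc d ≡ᵇ k) + indicator (overhangHookᵇ d [] k)
                               ≡ indicator (overhangHookᵇ (suc d) [] k)
overhangHookᵇ-[]-suc d       zero          = refl
overhangHookᵇ-[]-suc zero    (suc zero)    = refl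
overhangHookᵇ-[]-suc zero    (suc (suc k)) = refl
overhangHookᵇ-[]-suc (suc d) (suc zero)    = refl
overhangHookᵇ-[]-suc (suc d) (suc (suc k)) = overhangHookᵇ-[]-suc d (suc k)

<ᵇ-true : ∀ {m n} → m < n → (m <ᵇ n) ≡ true
<ᵇ-true m<n = Equivalence.to T-≡ (<⇒<ᵇ m<n)

<ᵇ-false : ∀ {m n} → n ≤ m → (m <ᵇ n) ≡ false
<ᵇ-false {m} {n} n≤m with m <ᵇ n in m<ᵇn
... | false = refl
... | true  = contradiction (<ᵇ⇒< m n (Equivalence.from T-≡ m<ᵇn)) (≤⇒≯ n≤m)

≡ᵇ-false : ∀ {m n} → m ≢ n → (m ≡ᵇ n) ≡ false
≡ᵇ-false {m} {n} m≢n with m ≡ᵇ n in m≡ᵇn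
... | false = refl
... | true  = contradiction (≡ᵇ⇒≡ m n (Equivalence.from T-≡ m≡ᵇn)) m≢n

+-≡ᵇ-cancelˡ : ∀ m n o → (m + n ≡ᵇ m + o) ≡ (n ≡ᵇ o)
+-≡ᵇ-cancelˡ zero    n o = refl
+-≡ᵇ-cancelˡ (suc m) n o = +-≡ᵇ-cancelˡ m n o

countGreater-≤ : ∀ {j} ν → All (_≤ j) ν → countGreater ν j ≡ 0
countGreater-≤ []      []           = refl
countGreater-≤ (y ∷ ν) (y≤j ∷ ν≤j) rewrite <ᵇ-false y≤j = countGreater-≤ ν ν≤j

hook-overhang-inner : ∀ {y} m ys {j} → j < y →
                      hook (y + m ∷ y ∷ ys) 0 j ≡ suc (m + hook (y ∷ ys) 0 j)
hook-overhang-inner {y} m ys {j} j<y rewrite +-∸-comm m j<y | <ᵇ-true j<y =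
  rearrange (y ∸ suc j) m (countGreater ys j)
  where
  open +-*-Solver
  rearrange : ∀ a m c → (a + m) + (1 + c) + 1 ≡ suc (m + (a + c + 1))
  rearrange = solve 3 (λ a m c → (a :+ m) :+ (con 1 :+ c) :+ con 1
                                 := con 1 :+ (m :+ (a :+ c :+ con 1))) refl

hook-overhang-outer : ∀ {y} m ys t → All (_≤ y) ys →
                      hook (y + m ∷ y ∷ ys) 0 (y + t) ≡ hook (m ∷ []) 0 t
hook-overhang-outer {y} m ys t ys≤y
  rewrite sym (+-suc y t) | [m+n]∸[m+o]≡n∸o y m (suc t)
        | countGreater-≤ (y ∷ ys) (All.map (λ z≤y → ≤-trans z≤y (m≤m+n y t)) (≤-refl ∷ ys≤y))
        = refl

NonIncreasing : List ℕ → Set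
NonIncreasing = AllPairs _≥_

singleRow-hookCount : ∀ m k →
                      countBelow (λ j → hook (m ∷ []) 0 j ≡ᵇ k) m ≡ indicator (topHookᵇ (m ∷ []) k)
singleRow-hookCount zero    zero    = refl
singleRow-hookCount zero    (suc k) = refl
singleRow-hookCount (suc m) k       = begin
  indicator (m + 0 + 1 ≡ᵇ k) + countBelow (λ j → hook (m ∷ []) 0 j ≡ᵇ k) m
    ≡⟨ cong₂ (λ h c → indicator (h ≡ᵇ k) + c) m+0+1≡1+m (singleRow-hookCount m k) ⟩
  indicator (suc m ≡ᵇ k) + indicator (overhangHookᵇ m [] k)
    ≡⟨ overhangHookᵇ-[]-suc m k ⟩
  indicator (overhangHookᵇ (suc m) [] k) ∎
  where
  open ≡-Reasoning
  m+0+1≡1+m : m + 0 + 1 ≡ suc m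
  m+0+1≡1+m = trans (cong (_+ 1) (+-identityʳ m)) (+-comm m 1)

topRow-hookCount : ∀ x ν k → NonIncreasing (x ∷ ν) →
                   countBelow (λ j → hook (x ∷ ν) 0 j ≡ᵇ k) x ≡ indicator (topHookᵇ (x ∷ ν) k)
topRow-hookCount x []       k _ = singleRow-hookCount x k
topRow-hookCount x (y ∷ ys) k ((y≤x ∷ _) ∷ ys≤y ∷ ys↓) with m≤n⇒∃[o]m+o≡n y≤x
... | m , refl rewrite m+n∸m≡n y m = begin
  countBelow p (y + m)
    ≡⟨ countBelow-+ p y m ⟩
  countBelow p y + countBelow (p ∘ (y +_)) m
    ≡⟨ cong (countBelow p y +_) outer ⟩
  countBelow p y + indicator (overhangHookᵇ m [] k)
    ≡⟨ inner (≤-<-connex k m) ⟩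
  indicator (overhangHookᵇ m (y ∷ ys) k) ∎
  where
  open ≡-Reasoning
  p : ℕ → Bool
  p j = hook (y + m ∷ y ∷ ys) 0 j ≡ᵇ k

  outer : countBelow (p ∘ (y +_)) m ≡ indicator (overhangHookᵇ m [] k)
  outer = trans (countBelow-cong m (λ {t} _ → cong (_≡ᵇ k) (hook-overhang-outer m ys t ys≤y)))
                (singleRow-hookCount m k)

  inner : k ≤ m ⊎ m < k →
          countBelow p y + indicator (overhangHookᵇ m [] k)
          ≡ indicator (overhangHookᵇ m (y ∷ ys) k)
  inner (inj₁ k≤m) = cong₂ _+_
    (countBelow-none y (λ j<y → trans (cong (_≡ᵇ k) (hook-overhang-inner m ys j<y))
                                      (≡ᵇ-false (>⇒≢ (s≤s (≤-trans k≤m (m≤m+n m _)))))))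
    (cong indicator (overhangHookᵇ-≤ [] (y ∷ ys) k≤m))
  inner (inj₂ m<k) with m≤n⇒∃[o]m+o≡n m<k
  ... | k′ , refl = begin
    countBelow p y + indicator (overhangHookᵇ m [] (suc (m + k′)))
      ≡⟨ cong₂ _+_ (countBelow-cong y shifted) (cong indicator (overhangHookᵇ-+ m [] k′)) ⟩
    countBelow (λ j → hook (y ∷ ys) 0 j ≡ᵇ k′) y + 0
      ≡⟨ +-identityʳ _ ⟩
    countBelow (λ j → hook (y ∷ ys) 0 j ≡ᵇ k′) y
      ≡⟨ topRow-hookCount y ys k′ (ys≤y ∷ ys↓) ⟩
    indicator (topHookᵇ (y ∷ ys) k′)
      ≡⟨ cong indicator (overhangHookᵇ-+ m (y ∷ ys) k′) ⟨
    indicator (overhangHookᵇ m (y ∷ ys) (suc (m + k′))) ∎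
    where
    shifted : ∀ {j} → j < y → p j ≡ (hook (y ∷ ys) 0 j ≡ᵇ k′)
    shifted j<y = trans (cong (_≡ᵇ suc (m + k′)) (hook-overhang-inner m ys j<y)) (+-≡ᵇ-cancelˡ m _ k′)

topRowHooks-count : ∀ k x ν → NonIncreasing (x ∷ ν) →
                    length (filterᵇ (_≡ᵇ k) (topRowHooks (x ∷ ν))) ≡ indicator (topHookᵇ (x ∷ ν) k)
topRowHooks-count k x ν x∷ν↓ = begin
  length (filterᵇ (_≡ᵇ k) (map (hook (x ∷ ν) 0) (upTo x)))
    ≡⟨ cong (length ∘ filterᵇ (_≡ᵇ k)) (map-upTo (hook (x ∷ ν) 0) x) ⟩
  length (filterᵇ (_≡ᵇ k) (applyUpTo (hook (x ∷ ν) 0) x))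
    ≡⟨ length-filterᵇ-applyUpTo (_≡ᵇ k) (hook (x ∷ ν) 0) x ⟩
  countBelow (λ j → hook (x ∷ ν) 0 j ≡ᵇ k) x
    ≡⟨ topRow-hookCount x ν k x∷ν↓ ⟩
  indicator (topHookᵇ (x ∷ ν) k) ∎
  where open ≡-Reasoning

rowsWithHook : ℕ → Partition → ℕ
rowsWithHook k []      = 0
rowsWithHook k (x ∷ ν) = indicator (topHookᵇ (x ∷ ν) k) + rowsWithHook k ν

numHooks≡rowsWithHook : ∀ k μ → NonIncreasing μ → numHooks k μ ≡ rowsWithHook k μ
numHooks≡rowsWithHook k []      []          = refl
numHooks≡rowsWithHook k (x ∷ ν) x∷ν↓@(_ ∷ ν↓) = begin
  length (filterᵇ (_≡ᵇ k) (hooks (x ∷ ν)))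
    ≡⟨ cong (length ∘ filterᵇ (_≡ᵇ k)) (hooks-∷ x ν) ⟩
  length (filterᵇ (_≡ᵇ k) (topRowHooks (x ∷ ν) ++ hooks ν))
    ≡⟨ length-filterᵇ-++ (_≡ᵇ k) (topRowHooks (x ∷ ν)) (hooks ν) ⟩
  length (filterᵇ (_≡ᵇ k) (topRowHooks (x ∷ ν))) + numHooks k ν
    ≡⟨ cong₂ _+_ (topRowHooks-count k x ν x∷ν↓) (numHooks≡rowsWithHook k ν ν↓) ⟩
  rowsWithHook k (x ∷ ν) ∎
  where open ≡-Reasoning

NoRowHook : ℕ → Partition → Set
NoRowHook k []      = ⊤
NoRowHook k (x ∷ ν) = topHookᵇ (x ∷ ν) k ≡ false × NoRowHook k ν

NoRowHook⇒topHookᵇ≡false : ∀ {k} μ → NoRowHook k μ → topHookᵇ μ k ≡ false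
NoRowHook⇒topHookᵇ≡false []      _           = refl
NoRowHook⇒topHookᵇ≡false (x ∷ ν) (no-k , _) = no-k

rowsWithHook≡0⇒NoRowHook : ∀ k μ → rowsWithHook k μ ≡ 0 → NoRowHook k μ
rowsWithHook≡0⇒NoRowHook k []      _  = tt
rowsWithHook≡0⇒NoRowHook k (x ∷ ν) eq =
  indicator≡0⇒false (m+n≡0⇒m≡0 _ eq) , rowsWithHook≡0⇒NoRowHook k ν (m+n≡0⇒n≡0 _ eq)

divides?-refl : ∀ t → divides? t t ≡ true
divides?-refl zero    = refl
divides?-refl (suc t) = cong (_≡ᵇ 0) (n%n≡0 (suc t))

core⇒numHooks≡0 : ∀ t μ → T (isCore t μ) → numHooks t μ ≡ 0
core⇒numHooks≡0 t μ = length-filterᵇ-none (not ∘ divides? t) (_≡ᵇ t) t-divides-t (hooks μ)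
  where
  t-divides-t : ∀ h → T (h ≡ᵇ t) → T (not (divides? t h)) → ⊥
  t-divides-t h h≡ᵇt rewrite ≡ᵇ⇒≡ h t h≡ᵇt | divides?-refl t = λ ()

core⇒NoRowHook : ∀ t μ → NonIncreasing μ → T (isCore t μ) → NoRowHook t μ
core⇒NoRowHook t μ μ↓ core =
  rowsWithHook≡0⇒NoRowHook t μ (begin
    rowsWithHook t μ ≡⟨ numHooks≡rowsWithHook t μ μ↓ ⟨
    numHooks t μ     ≡⟨ core⇒numHooks≡0 t μ core ⟩
    0                ∎)
  where open ≡-Reasoning

-- A top row with a k-hook but no l-hook is spare: it can absorb an l-hook of
-- the row above that has no k-hook.
spare : ℕ → ℕ → Partition → ℕ
spare k l μ = indicator (topHookᵇ μ k ∧ not (topHookᵇ μ l))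

SpareStep : ℕ → ℕ → ℕ → Set
SpareStep t k l = ∀ x ν → NoRowHook t (x ∷ ν) →
  indicator (topHookᵇ (x ∷ ν) l) + spare k l (x ∷ ν)
  ≤ indicator (topHookᵇ (x ∷ ν) k) + spare k l ν

rowsWithHook-telescope : ∀ {t k l} → SpareStep t k l →
                         ∀ μ → NoRowHook t μ → rowsWithHook l μ + spare k l μ ≤ rowsWithHook k μ
rowsWithHook-telescope step []      _                  = z≤n
rowsWithHook-telescope {k = k} {l} step (x ∷ ν) no-t@(_ , no-tν) = begin
  (hasL + rowsWithHook l ν) + spare k l (x ∷ ν) ≡⟨ xy∙z≈xz∙y hasL _ _ ⟩
  (hasL + spare k l (x ∷ ν)) + rowsWithHook l ν ≤⟨ +-monoˡ-≤ _ (step x ν no-t) ⟩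
  (hasK + spare k l ν) + rowsWithHook l ν       ≡⟨ xy∙z≈x∙zy hasK _ _ ⟩
  hasK + (rowsWithHook l ν + spare k l ν)       ≤⟨ +-monoʳ-≤ hasK rest ⟩
  hasK + rowsWithHook k ν                       ∎
  where
  open ≤-Reasoning
  hasK hasL : ℕ
  hasK = indicator (topHookᵇ (x ∷ ν) k)
  hasL = indicator (topHookᵇ (x ∷ ν) l)
  rest : rowsWithHook l ν + spare k l ν ≤ rowsWithHook k ν
  rest = rowsWithHook-telescope step ν no-tν

spareStep-2≤1 : SpareStep 3 1 2
spareStep-2≤1 x ν (no-3 , _) = overhang (x ∸ part ν 0) no-3
  where
  overhang : ∀ d → overhangHookᵇ d ν 3 ≡ false →
             indicator (overhangHookᵇ d ν 2)
             + indicator (overhangHookᵇ d ν 1 ∧ not (overhangHookᵇ d ν 2))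
             ≤ indicator (overhangHookᵇ d ν 1) + spare 1 2 ν
  overhang zero no-3 rewrite topHookᵇ-0 ν | no-3 with topHookᵇ ν 1
  ... | true  = ≤-refl
  ... | false = ≤-refl
  overhang (suc zero)    _ rewrite topHookᵇ-0 ν = s≤s z≤n
  overhang (suc (suc d)) _ = s≤s z≤n

-- A top row without a 1-hook does not overhang, so a 4-hook in it would sit
-- above a 3-hook of the next row.
no-1-hook⇒no-4-hook : ∀ μ → topHookᵇ μ 1 ≡ false → NoRowHook 3 μ → topHookᵇ μ 4 ≡ false
no-1-hook⇒no-4-hook []      _ _ = refl
no-1-hook⇒no-4-hook (x ∷ ν) no-1 (_ , no-3ν) with x ∸ part ν 0
... | zero = NoRowHook⇒topHookᵇ≡false ν no-3ν
no-1-hook⇒no-4-hook (x ∷ ν) () _ | suc _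

spareStep-4≤2 : SpareStep 3 2 4
spareStep-4≤2 x ν (no-3 , no-3ν) = overhang (x ∸ part ν 0) no-3
  where
  overhang : ∀ d → overhangHookᵇ d ν 3 ≡ false →
             indicator (overhangHookᵇ d ν 4)
             + indicator (overhangHookᵇ d ν 2 ∧ not (overhangHookᵇ d ν 4))
             ≤ indicator (overhangHookᵇ d ν 2) + spare 2 4 ν
  overhang zero _ rewrite NoRowHook⇒topHookᵇ≡false ν no-3ν with topHookᵇ ν 1
  ... | true  = s≤s z≤n
  ... | false = z≤n
  overhang (suc zero) no-1ν rewrite topHookᵇ-0 ν | no-1-hook⇒no-4-hook ν no-1ν no-3ν
    with topHookᵇ ν 2
  ... | true  = ≤-refl
  ... | false = ≤-refl
  overhang (suc (suc d)) _ with overhangHookᵇ (suc (suc d)) ν 4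
  ... | true  = s≤s z≤n
  ... | false = s≤s z≤n

core-numHooks-≤ : ∀ {t k l} → SpareStep t k l →
                  ∀ {μ} → NonIncreasing μ → T (isCore t μ) → numHooks l μ ≤ numHooks k μ
core-numHooks-≤ {t} {k} {l} step {μ} μ↓ core = begin
  numHooks l μ                     ≡⟨ numHooks≡rowsWithHook l μ μ↓ ⟩
  rowsWithHook l μ                 ≤⟨ m≤m+n _ _ ⟩
  rowsWithHook l μ + spare k l μ   ≤⟨ rowsWithHook-telescope step μ no-t ⟩
  rowsWithHook k μ                 ≡⟨ numHooks≡rowsWithHook k μ μ↓ ⟨
  numHooks k μ                     ∎
  where
  open ≤-Reasoning
  no-t : NoRowHook t μ
  no-t = core⇒NoRowHook t μ μ↓ core

BoundedBy : ℕ → Partition → Set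
BoundedBy m μ = NonIncreasing μ × All (_≤ m) μ

partsLE'-boundedBy : ∀ f m n → All (BoundedBy m) (partsLE' f m n)
partsLE'-boundedBy zero    m zero    = ([] , []) ∷ []
partsLE'-boundedBy zero    m (suc n) = []
partsLE'-boundedBy (suc f) m zero    = ([] , []) ∷ []
partsLE'-boundedBy (suc f) m (suc n) =
  concat⁺ (map⁺ (filterᵇ-All (λ k → suc k ≤ᵇ m) prepend-all (upTo (suc n))))
  where
  prepend-all : ∀ k → T (suc k ≤ᵇ m) →
                All (BoundedBy m) (map (suc k ∷_) (partsLE' f (suc k) (suc n ∸ suc k)))
  prepend-all k 1+k≤ᵇm = map⁺ (All.map prepend (partsLE'-boundedBy f (suc k) (suc n ∸ suc k)))
    where
    1+k≤m : suc k ≤ m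
    1+k≤m = ≤ᵇ⇒≤ (suc k) m 1+k≤ᵇm
    prepend : ∀ {ν} → BoundedBy (suc k) ν → BoundedBy m (suc k ∷ ν)
    prepend (ν↓ , ν≤1+k) =
      (ν≤1+k ∷ ν↓) , (1+k≤m ∷ All.map (λ z≤1+k → ≤-trans z≤1+k 1+k≤m) ν≤1+k)

partitions-nonIncreasing : ∀ n → All NonIncreasing (partitions n)
partitions-nonIncreasing n = All.map proj₁ (partsLE'-boundedBy n n n)

a-mono : ∀ {t k l} → SpareStep t k l → ∀ n → a t l n ≤ a t k n
a-mono {t} step n =
  sum-map-filterᵇ-mono (isCore t) (All.map (core-numHooks-≤ step) (partitions-nonIncreasing n))

theorem1p3 : (n : ℕ) → (a 3 2 n ≤ a 3 1 n) × (a 3 4 n ≤ a 3 2 n)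
theorem1p3 n = a-mono spareStep-2≤1 n , a-mono spareStep-4≤2 n
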